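{- Let $G$ be a graph and let $u,v\in V(G)$. If no maximal induced matching of $G$ covers both $u$ and $v$, then $|M_{G_{T_G(u)\rightarrow v}}|\geq |M_G|$ or $|M_{G_{T_G(v)\rightarrow u}}|\geq |M_G|$.
   Context: All graphs are finite, simple and undirected; $N_G(x)$ denotes the open neighborhood of $x$. A matching in $G$ is a set of edges no two of which share an endpoint; it covers a vertex $x$ if $x$ is an endpoint of one of its edges; it is induced if the subgraph of $G$ induced by the endpoints of its edges is $1$-regular; an induced matching is maximal if it is not properly contained in another induced matching of $G$. $M_G$ denotes the set of all maximal induced matchings of $G$. For $x\in V(G)$, the twin set of $x$ is $T_G(x)=\{y\in V(G): N_G(y)=N_G(x)\}$. For two non-adjacent vertices $u,v$ of $G$, $G_{T_G(u)\rightarrow v}$ is the graph obtained from $G$ as follows: for every $u'\in T_G(u)$, delete the edge $u'x$ for every $x\in N_G(u)\setminus N_G(v)$ and add the edge $u'y$ for every $y\in N_G(v)\setminus N_G(u)$. (The hypothesis forces $u,v$ to be non-adjacent, since an edge $uv$ would lie in some maximal induced matching.) -}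

module Defs where

open import Data.Nat using (ℕ)
open import Data.Fin using (Fin)
open import Data.Bool using (Bool; true; false)
open import Data.Vec using (Vec; lookup)
open import Data.List using (List; length)
open import Data.List.Membership.Propositional using (_∈_)
open import Data.List.Relation.Unary.Unique.Propositional using (Unique)
open import Data.Product using (Σ; ∃; _×_; _,_)
open import Data.Sum using (_⊎_)
open import Relation.Nullary using (¬_)
open import Data.Empty using (⊥)
open import Relation.Binary.PropositionalEquality using (_≡_; _≢_)
open import Function.Bundles using (_⇔_)

record Graph (n : ℕ) : Set₁ where
  field
    E      : Fin n → Fin n → Set
    sym    : ∀ x y → E x y → E y x
    irrefl : ∀ x → ¬ E x x
open Graph public

Adj : ℕ → Set₁
Adj n = Fin n → Fin n → Set

-- A set of (unordered) vertex pairs, stored as a 0/1 matrix: x and y are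
-- joined by an edge of the set iff entry (x,y) is true.  Matchings below are
-- required to be symmetric, so each edge set has exactly one representation.
EdgeSet : ℕ → Set
EdgeSet n = Vec (Vec Bool n) n

_∋ₑ_─_ : ∀ {n} → EdgeSet n → Fin n → Fin n → Set
M ∋ₑ x ─ y = lookup (lookup M x) y ≡ true

IsMatching : ∀ {n} → Adj n → EdgeSet n → Set
IsMatching E M =
    (∀ x y → M ∋ₑ x ─ y → E x y)
  × (∀ x y → M ∋ₑ x ─ y → M ∋ₑ y ─ x)
  × (∀ x y z → M ∋ₑ x ─ y → M ∋ₑ x ─ z → y ≡ z)

Covers : ∀ {n} → EdgeSet n → Fin n → Set
Covers M x = ∃ λ y → M ∋ₑ x ─ y

-- The subgraph induced by the covered vertices is 1-regular: every covered
-- vertex has exactly one neighbour among the covered vertices.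
IsInducedMatching : ∀ {n} → Adj n → EdgeSet n → Set
IsInducedMatching E M =
  IsMatching E M ×
  (∀ x → Covers M x →
     (∃ λ y → Covers M y × E x y) ×
     (∀ y z → Covers M y → E x y → Covers M z → E x z → y ≡ z))

_⊆ₑ_ : ∀ {n} → EdgeSet n → EdgeSet n → Set
M ⊆ₑ M' = ∀ x y → M ∋ₑ x ─ y → M' ∋ₑ x ─ y

IsMaximalInducedMatching : ∀ {n} → Adj n → EdgeSet n → Set
IsMaximalInducedMatching E M =
  IsInducedMatching E M ×
  (∀ M' → IsInducedMatching E M' → M ⊆ₑ M' → M ≢ M' → ⊥)

HasCount : ∀ {n} → (EdgeSet n → Set) → ℕ → Set
HasCount {n} P k =
  Σ (List (EdgeSet n)) λ l → length l ≡ k × Unique l × (∀ M → (M ∈ l) ⇔ P M)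

InTwinSet : ∀ {n} → Adj n → Fin n → Fin n → Set
InTwinSet E x y = ∀ z → E y z ⇔ E x z

-- G_{T(u) → v}: for every u' ∈ T(u), delete u'x for x ∈ N(u) \ N(v) and add
-- u'y for y ∈ N(v) \ N(u).  Edges are unordered, so both orientations are
-- treated symmetrically.
Deleted : ∀ {n} → Adj n → Fin n → Fin n → Adj n
Deleted E u v a b =
    (InTwinSet E u a × E u b × ¬ E v b)
  ⊎ (InTwinSet E u b × E u a × ¬ E v a)

Added : ∀ {n} → Adj n → Fin n → Fin n → Adj n
Added E u v a b =
    (InTwinSet E u a × E v b × ¬ E u b)
  ⊎ (InTwinSet E u b × E v a × ¬ E u a)

twinShift : ∀ {n} → Adj n → Fin n → Fin n → Adj n
twinShift E u v a b = (E a b × ¬ Deleted E u v a b) ⊎ Added E u v a b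

module Submission where

-- Let E' = G_{T(u)→v} and call a maximal induced matching (MIM) "of G"
-- or "of G'".  If no MIM of G covers both u and v, then u and v are not
-- adjacent, and whichever of u, v is covered by more MIMs of G -- say v --
-- gives |M_G| ≤ |M_{G'}|, by an explicit injection M_G → M_{G'}:
--   * a MIM of G covering no vertex of T(u) is still a MIM of G';
--   * a MIM M of G covering some w ∈ T(u) covers exactly one such w; the
--     transposition (w u) moves it to a MIM covering u, a fixed injection
--     pairs that with a MIM of G covering v (this is where the counting
--     hypothesis enters), which is a MIM of G' avoiding T(u), and the
--     transposition (v w), an automorphism of G', moves it to a MIM of G'
--     covering w.  The
-- adjacency relation is not assumed decidable: since the conclusion is a
-- decidable statement it suffices to prove it under the double-negated
-- assumption that adjacency is decidable.

open import Defs hiding (sym)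
open import Data.Nat using (ℕ; zero; suc; _+_; _*_; _≤_; _<_; z≤n; s≤s; _≤?_)
open import Data.Nat.Properties
  using (≤-trans; ≤-reflexive; ≤-total; m≤n⇒m≤1+n; +-mono-≤; +-monoʳ-<; +-mono-<-≤;
         <⇒≱; <-≤-trans; +-suc; +-identityʳ; m≤n+m; ≤-refl; module ≤-Reasoning)
open import Data.Fin using (Fin; zero; suc; _≟_)
open import Data.Fin.Properties using (any?; all?)
open import Data.Fin.Permutation.Components using (transpose)
open import Data.Bool using (Bool; true; false)
import Data.Bool as Bool
open import Data.Vec using (Vec; []; _∷_; lookup; tabulate)
open import Data.Vec.Properties using (lookup∘tabulate; tabulate∘lookup; tabulate-cong; ≡-dec)
open import Data.List using (List; []; _∷_; length; filter)
open import Data.List.Properties using (length-removeAt′)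
open import Data.List.Membership.Propositional using (_∈_)
open import Data.List.Membership.Propositional.Properties using (∈-filter⁺; ∈-filter⁻)
open import Data.List.Relation.Unary.Any as Any using (here; there; _─_)
import Data.List.Relation.Unary.All as All
open import Data.List.Relation.Unary.AllPairs using ([]; _∷_)
open import Data.List.Relation.Unary.Unique.Propositional using (Unique)
import Data.List.Relation.Unary.Unique.Propositional.Properties as Unique
open import Data.Product using (∃; _×_; _,_; proj₁; proj₂; uncurry)
open import Data.Sum using (_⊎_; inj₁; inj₂)
open import Data.Empty using (⊥; ⊥-elim)
open import Data.Unit using (⊤; tt)
open import Relation.Nullary using (¬_; Dec; yes; no)
open import Relation.Nullary.Decidable
  using (_×-dec_; _⊎-dec_; _→-dec_; map′; decidable-stable; dec-true; dec-false; ¬¬-excluded-middle; does)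
open import Relation.Binary.Definitions using (DecidableEquality; Decidable)
open import Relation.Binary.PropositionalEquality
open import Function.Base using (_∘_)
open import Function.Bundles using (_⇔_; mk⇔; Equivalence)
import Function.Properties.Equivalence as ⇔
open Equivalence using (to; from)

_⇔-dec_ : {A B : Set} → Dec A → Dec B → Dec (A ⇔ B)
a? ⇔-dec b? = map′ (uncurry mk⇔) (λ e → to e , from e) ((a? →-dec b?) ×-dec (b? →-dec a?))

¬¬-∀-Fin : ∀ {m} {P : Fin m → Set} → (∀ i → ¬ ¬ P i) → ¬ ¬ (∀ i → P i)
¬¬-∀-Fin {zero} _ k = k (λ ())
¬¬-∀-Fin {suc m} {P} h k =
  h zero λ p₀ → ¬¬-∀-Fin {m} {λ i → P (suc i)} (λ i → h (suc i)) λ ps →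
  k λ { zero → p₀ ; (suc i) → ps i }

¬¬-decidable : ∀ {m} (R : Fin m → Fin m → Set) → ¬ ¬ Decidable R
¬¬-decidable R = ¬¬-∀-Fin (λ x → ¬¬-∀-Fin (λ y → ¬¬-excluded-middle))


module _ {A : Set} where

  ∈-─ : ∀ {x z} {ys : List A} (x∈ys : x ∈ ys) → z ∈ ys → z ≢ x → z ∈ (ys ─ x∈ys)
  ∈-─ (here refl)  (here refl)  z≢x = ⊥-elim (z≢x refl)
  ∈-─ (here refl)  (there z∈ys) _   = z∈ys
  ∈-─ (there _)    (here refl)  _   = here refl
  ∈-─ (there x∈ys) (there z∈ys) z≢x = there (∈-─ x∈ys z∈ys z≢x)

module _ {A B : Set} where

  injection-length : ∀ (xs : List A) (ys : List B) (f : A → B) → Unique xs →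
    (∀ {x} → x ∈ xs → f x ∈ ys) →
    (∀ {x y} → x ∈ xs → y ∈ xs → f x ≡ f y → x ≡ y) →
    length xs ≤ length ys
  injection-length []       ys f _              _    _   = z≤n
  injection-length (x ∷ xs) ys f (x∉xs ∷ xs-uniq) into inj = begin
    suc (length xs)           ≤⟨ s≤s (injection-length xs (ys ─ fx∈ys) f xs-uniq into′ inj′) ⟩
    suc (length (ys ─ fx∈ys)) ≡⟨ sym (length-removeAt′ ys _) ⟩
    length ys                 ∎
    where
    open ≤-Reasoning
    fx∈ys : f x ∈ ys
    fx∈ys = into (here refl)
    into′ : ∀ {y} → y ∈ xs → f y ∈ (ys ─ fx∈ys)
    into′ y∈xs = ∈-─ fx∈ys (into (there y∈xs))
      (λ fy≡fx → All.lookup x∉xs y∈xs (sym (inj (there y∈xs) (here refl) fy≡fx)))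
    inj′ : ∀ {y z} → y ∈ xs → z ∈ xs → f y ≡ f z → y ≡ z
    inj′ y∈xs z∈xs = inj (there y∈xs) (there z∈xs)

module _ {A : Set} (_≟ᴬ_ : DecidableEquality A) where

  pairing : List A → List A → A → A
  pairing (x ∷ xs) (y ∷ ys) a with a ≟ᴬ x
  ... | yes _ = y
  ... | no  _ = pairing xs ys a
  pairing _ _ a = a

  pairing-∈ : ∀ xs ys → length xs ≤ length ys → ∀ {a} → a ∈ xs → pairing xs ys a ∈ ys
  pairing-∈ (x ∷ xs) (y ∷ ys) (s≤s le) {a} a∈ with a ≟ᴬ x
  ... | yes _   = here refl
  ... | no  a≢x = there (pairing-∈ xs ys le (Any.tail a≢x a∈))

  pairing-injective : ∀ xs ys → length xs ≤ length ys → Unique ys → ∀ {a b} → a ∈ xs → b ∈ xs →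
    pairing xs ys a ≡ pairing xs ys b → a ≡ b
  pairing-injective (x ∷ xs) (y ∷ ys) (s≤s le) (y∉ys ∷ ys-uniq) {a} {b} a∈ b∈ eq
    with a ≟ᴬ x | b ≟ᴬ x
  ... | yes a≡x | yes b≡x = trans a≡x (sym b≡x)
  ... | yes _   | no  b≢x = ⊥-elim (All.lookup y∉ys (pairing-∈ xs ys le (Any.tail b≢x b∈)) eq)
  ... | no  a≢x | yes _   = ⊥-elim (All.lookup y∉ys (pairing-∈ xs ys le (Any.tail a≢x a∈)) (sym eq))
  ... | no  a≢x | no  b≢x =
    pairing-injective xs ys le ys-uniq (Any.tail a≢x a∈) (Any.tail b≢x b∈) eq


-- Vertex involutions acting on edge sets.

module _ {n : ℕ} where

  Involution : (Fin n → Fin n) → Set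
  Involution τ = ∀ x → τ (τ x) ≡ x

  module _ (a b : Fin n) where

    transpose-left : transpose a b a ≡ b
    transpose-left rewrite dec-true (a ≟ a) refl = refl

    transpose-right : transpose a b b ≡ a
    transpose-right with b ≟ a
    ... | yes b≡a = b≡a
    ... | no  _ rewrite dec-true (b ≟ b) refl = refl

    transpose-other : ∀ {x} → x ≢ a → x ≢ b → transpose a b x ≡ x
    transpose-other {x} x≢a x≢b rewrite dec-false (x ≟ a) x≢a | dec-false (x ≟ b) x≢b = refl

    transpose-involutive : Involution (transpose a b)
    transpose-involutive x = by-cases (x ≟ a) (x ≟ b)
      where
      by-cases : Dec (x ≡ a) → Dec (x ≡ b) → transpose a b (transpose a b x) ≡ x
      by-cases (yes refl) _          = trans (cong (transpose a b) transpose-left) transpose-right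
      by-cases (no _)     (yes refl) = trans (cong (transpose a b) transpose-right) transpose-left
      by-cases (no x≢a)   (no x≢b)   =
        trans (cong (transpose a b) (transpose-other x≢a x≢b)) (transpose-other x≢a x≢b)

    transpose-twins-neighbours : (E : Adj n) → InTwinSet E a b →
      ∀ x z → E x z → E (transpose a b x) z
    transpose-twins-neighbours E twin x z exz = by-cases (x ≟ a) (x ≟ b)
      where
      by-cases : Dec (x ≡ a) → Dec (x ≡ b) → E (transpose a b x) z
      by-cases (yes refl) _          = subst (λ w → E w z) (sym transpose-left) (from (twin z) exz)
      by-cases (no _)     (yes refl) = subst (λ w → E w z) (sym transpose-right) (to (twin z) exz)
      by-cases (no x≢a)   (no x≢b)   = subst (λ w → E w z) (sym (transpose-other x≢a x≢b)) exz

    transpose-twins-hom : (E : Adj n) → (∀ x y → E x y → E y x) → InTwinSet E a b →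
      ∀ x y → E x y → E (transpose a b x) (transpose a b y)
    transpose-twins-hom E E-sym twin x y exy =
      E-sym _ _ (step y _ (E-sym _ _ (step x y exy)))
      where step = transpose-twins-neighbours E twin

  relabel : (Fin n → Fin n) → EdgeSet n → EdgeSet n
  relabel τ M = tabulate (λ x → tabulate (λ y → lookup (lookup M (τ x)) (τ y)))

  lookup-relabel : ∀ τ M x y → lookup (lookup (relabel τ M) x) y ≡ lookup (lookup M (τ x)) (τ y)
  lookup-relabel τ M x y =
    trans (cong (λ row → lookup row y) (lookup∘tabulate _ x)) (lookup∘tabulate _ y)

  relabel-∋ : ∀ τ M {x y} → relabel τ M ∋ₑ x ─ y ⇔ M ∋ₑ τ x ─ τ y
  relabel-∋ τ M {x} {y} = mk⇔ (trans (sym (lookup-relabel τ M x y))) (trans (lookup-relabel τ M x y))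

  module _ (τ : Fin n → Fin n) (τ-inv : Involution τ) where

    τ-injective : ∀ {a b} → τ a ≡ τ b → a ≡ b
    τ-injective {a} {b} eq = trans (sym (τ-inv a)) (trans (cong τ eq) (τ-inv b))

    relabel-involutive : ∀ M → relabel τ (relabel τ M) ≡ M
    relabel-involutive M = begin
      relabel τ (relabel τ M)
        ≡⟨ tabulate-cong (λ x → tabulate-cong (λ y →
             trans (lookup-relabel τ M (τ x) (τ y))
                   (cong₂ (λ p q → lookup (lookup M p) q) (τ-inv x) (τ-inv y)))) ⟩
      tabulate (λ x → tabulate (lookup (lookup M x)))
        ≡⟨ tabulate-cong (λ x → tabulate∘lookup (lookup M x)) ⟩
      tabulate (lookup M)
        ≡⟨ tabulate∘lookup M ⟩
      M ∎
      where open ≡-Reasoning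

    relabel-injective : ∀ {M M'} → relabel τ M ≡ relabel τ M' → M ≡ M'
    relabel-injective {M} {M'} eq =
      trans (sym (relabel-involutive M)) (trans (cong (relabel τ) eq) (relabel-involutive M'))

    relabel-∋-image : ∀ M {x y} → M ∋ₑ x ─ y → relabel τ M ∋ₑ τ x ─ τ y
    relabel-∋-image M {x} {y} p =
      from (relabel-∋ τ M) (subst₂ (λ p q → M ∋ₑ p ─ q) (sym (τ-inv x)) (sym (τ-inv y)) p)

    covers-relabel : ∀ M {x} → Covers (relabel τ M) x ⇔ Covers M (τ x)
    covers-relabel M {x} = mk⇔
      (λ (y , p) → τ y , to (relabel-∋ τ M) p)
      (λ (y , p) → τ y , from (relabel-∋ τ M) (subst (λ q → M ∋ₑ τ x ─ q) (sym (τ-inv y)) p))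

    covers-relabel-image : ∀ M {x} → Covers M x → Covers (relabel τ M) (τ x)
    covers-relabel-image M {x} c = from (covers-relabel M) (subst (Covers M) (sym (τ-inv x)) c)


-- General facts about induced matchings.

module _ {n : ℕ} where

  IsMIM : Adj n → EdgeSet n → Set
  IsMIM = IsMaximalInducedMatching

  module _ {E : Adj n} (τ : Fin n → Fin n) (τ-inv : Involution τ)
           (τ-hom : ∀ a b → E a b → E (τ a) (τ b)) where

    IM-relabel : ∀ M → IsInducedMatching E M → IsInducedMatching E (relabel τ M)
    IM-relabel M ((edges , symm , func) , induced) =
      ( (λ x y p → subst₂ E (τ-inv x) (τ-inv y) (τ-hom _ _ (edges _ _ (to ∋M p))))
      , (λ x y p → from ∋M (symm _ _ (to ∋M p)))
      , (λ x y z p q → τ-injective τ τ-inv (func _ _ _ (to ∋M p) (to ∋M q))) )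
      , λ x c → neighbour x c , unique x c
      where
      ∋M : ∀ {x y} → relabel τ M ∋ₑ x ─ y ⇔ M ∋ₑ τ x ─ τ y
      ∋M = relabel-∋ τ M
      covers : ∀ {x} → Covers (relabel τ M) x → Covers M (τ x)
      covers = to (covers-relabel τ τ-inv M)
      neighbour : ∀ x → Covers (relabel τ M) x → ∃ λ y → Covers (relabel τ M) y × E x y
      neighbour x c with proj₁ (induced (τ x) (covers c))
      ... | y , cy , exy = τ y , covers-relabel-image τ τ-inv M cy
                                , subst (λ q → E q (τ y)) (τ-inv x) (τ-hom _ _ exy)
      unique : ∀ x → Covers (relabel τ M) x → ∀ y z → Covers (relabel τ M) y → E x y →
               Covers (relabel τ M) z → E x z → y ≡ z
      unique x c y z cy exy cz exz = τ-injective τ τ-inv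
        (proj₂ (induced (τ x) (covers c)) (τ y) (τ z) (covers cy) (τ-hom _ _ exy) (covers cz) (τ-hom _ _ exz))

    MIM-relabel : ∀ M → IsMIM E M → IsMIM E (relabel τ M)
    MIM-relabel M (im , maximal) = IM-relabel M im , λ M' im' M⊆M' M≢M' →
      maximal (relabel τ M') (IM-relabel M' im')
        (λ x y p → from (relabel-∋ τ M') (M⊆M' _ _ (relabel-∋-image τ τ-inv M p)))
        (λ M≡ → M≢M' (trans (cong (relabel τ) M≡) (relabel-involutive τ τ-inv M')))

  IM-transfer : ∀ {E E' : Adj n} (S : Fin n → Set) M → (∀ x → Covers M x → S x) →
    (∀ x y → S x → S y → E x y ⇔ E' x y) → IsInducedMatching E M → IsInducedMatching E' M
  IM-transfer {E} {E'} S M inS agree ((edges , symm , func) , induced) =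
    ( (λ x y p → to (agree' (y , p) (x , symm x y p)) (edges x y p)) , symm , func )
    , λ x c → let (y , cy , exy) , unique = induced x c in
      (y , cy , to (agree' c cy) exy)
      , λ y z cy exy cz exz → unique y z cy (from (agree' c cy) exy) cz (from (agree' c cz) exz)
    where
    agree' : ∀ {x y} → Covers M x → Covers M y → E x y ⇔ E' x y
    agree' {x} {y} cx cy = agree x y (inS x cx) (inS y cy)

  MIM-transfer : ∀ {E E' : Adj n} → (∀ x y → E x y ⇔ E' x y) → ∀ M → IsMIM E M → IsMIM E' M
  MIM-transfer agree M (im , maximal) =
    transfer agree M im , λ M' im' → maximal M' (transfer (λ x y → ⇔.sym (agree x y)) M' im')
    where
    transfer : ∀ {E E' : Adj n} → (∀ x y → E x y ⇔ E' x y) →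
               ∀ M → IsInducedMatching E M → IsInducedMatching E' M
    transfer agree M = IM-transfer (λ _ → ⊤) M (λ _ _ → tt) (λ x y _ _ → agree x y)

  -- No induced matching covers two distinct vertices a, b with N(a) ⊆ N(b):
  -- the partner p of a is a covered neighbour of b, hence b's partner, so p
  -- would be matched to both a and b.
  dominated-not-both-covered : ∀ {E : Adj n} M → IsInducedMatching E M → ∀ {a b} →
    (∀ z → E a z → E b z) → a ≢ b → Covers M a → Covers M b → ⊥
  dominated-not-both-covered M ((edges , symm , func) , induced) {a} {b} N[a]⊆N[b] a≢b (p , ap) (q , bq) =
    a≢b (func p a b (symm a p ap) (subst (λ r → M ∋ₑ r ─ b) (sym p≡q) (symm b q bq)))
    where
    p≡q : p ≡ q
    p≡q = proj₂ (induced b (q , bq)) p q (a , symm a p ap) (N[a]⊆N[b] p (edges a p ap))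
                                         (b , symm b q bq) (edges b q bq)


-- Extension to maximal elements, measured by the number of edges.

rowWeight : ∀ {k} → Vec Bool k → ℕ
rowWeight []          = 0
rowWeight (true ∷ r)  = suc (rowWeight r)
rowWeight (false ∷ r) = rowWeight r

weight : ∀ {m k} → Vec (Vec Bool k) m → ℕ
weight []      = 0
weight (r ∷ M) = rowWeight r + weight M

_⊑_ : ∀ {k} → Vec Bool k → Vec Bool k → Set
r ⊑ r' = ∀ i → lookup r i ≡ true → lookup r' i ≡ true

rowWeight-bound : ∀ {k} (r : Vec Bool k) → rowWeight r ≤ k
rowWeight-bound []          = z≤n
rowWeight-bound (true ∷ r)  = s≤s (rowWeight-bound r)
rowWeight-bound (false ∷ r) = m≤n⇒m≤1+n (rowWeight-bound r)

weight-bound : ∀ {m k} (M : Vec (Vec Bool k) m) → weight M ≤ m * k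
weight-bound []      = z≤n
weight-bound (r ∷ M) = +-mono-≤ (rowWeight-bound r) (weight-bound M)

rowWeight-mono : ∀ {k} (r r' : Vec Bool k) → r ⊑ r' → rowWeight r ≤ rowWeight r'
rowWeight-mono []          []           _  = z≤n
rowWeight-mono (true ∷ r)  (true ∷ r')  sub = s≤s (rowWeight-mono r r' (λ i → sub (suc i)))
rowWeight-mono (true ∷ r)  (false ∷ r') sub with sub zero refl
... | ()
rowWeight-mono (false ∷ r) (true ∷ r')  sub = m≤n⇒m≤1+n (rowWeight-mono r r' (λ i → sub (suc i)))
rowWeight-mono (false ∷ r) (false ∷ r') sub = rowWeight-mono r r' (λ i → sub (suc i))

rowWeight-strict : ∀ {k} (r r' : Vec Bool k) → r ⊑ r' → r ≢ r' → rowWeight r < rowWeight r'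
rowWeight-strict []          []           _  r≢r' = ⊥-elim (r≢r' refl)
rowWeight-strict (true ∷ r)  (true ∷ r')  sub r≢r' =
  s≤s (rowWeight-strict r r' (λ i → sub (suc i)) (λ eq → r≢r' (cong (true ∷_) eq)))
rowWeight-strict (true ∷ r)  (false ∷ r') sub _ with sub zero refl
... | ()
rowWeight-strict (false ∷ r) (true ∷ r')  sub _    = s≤s (rowWeight-mono r r' (λ i → sub (suc i)))
rowWeight-strict (false ∷ r) (false ∷ r') sub r≢r' =
  rowWeight-strict r r' (λ i → sub (suc i)) (λ eq → r≢r' (cong (false ∷_) eq))

weight-mono : ∀ {m k} (M M' : Vec (Vec Bool k) m) → (∀ x → lookup M x ⊑ lookup M' x) →
  weight M ≤ weight M'
weight-mono []      []        _  = z≤n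
weight-mono (r ∷ M) (r' ∷ M') sub = +-mono-≤ (rowWeight-mono r r' (sub zero)) (weight-mono M M' (λ x → sub (suc x)))

weight-strict : ∀ {m k} (M M' : Vec (Vec Bool k) m) → (∀ x → lookup M x ⊑ lookup M' x) →
  M ≢ M' → weight M < weight M'
weight-strict []      []        _  M≢M' = ⊥-elim (M≢M' refl)
weight-strict (r ∷ M) (r' ∷ M') sub M≢M' with ≡-dec Bool._≟_ r r'
... | yes refl = +-monoʳ-< (rowWeight r)
                   (weight-strict M M' (λ x → sub (suc x)) (λ eq → M≢M' (cong (r ∷_) eq)))
... | no  r≢r' = +-mono-<-≤ (rowWeight-strict r r' (sub zero) r≢r') (weight-mono M M' (λ x → sub (suc x)))

module _ {n : ℕ} (P : EdgeSet n → Set) where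

  IsMaximal : EdgeSet n → Set
  IsMaximal M = P M × (∀ M' → P M' → M ⊆ₑ M' → M ≢ M' → ⊥)

  -- Every edge set with property P lies, up to double negation, in a maximal
  -- one: otherwise it has a proper P-superset, of larger weight, and so on,
  -- beyond the bound n * n.
  extend-to-maximal : ∀ M → P M → ¬ ¬ (∃ λ M* → IsMaximal M* × M ⊆ₑ M*)
  extend-to-maximal M₀ = go (n * n) M₀ (m≤n+m (n * n) (weight M₀))
    where
    go : ∀ k M → n * n ≤ weight M + k → P M → ¬ ¬ (∃ λ M* → IsMaximal M* × M ⊆ₑ M*)
    go k M bound PM no-max = no-max (M , (PM , maximal) , λ _ _ p → p)
      where
      maximal : ∀ M' → P M' → M ⊆ₑ M' → M ≢ M' → ⊥
      maximal M' PM' M⊆M' M≢M' = beyond k bound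
        where
        heavier : weight M < weight M'
        heavier = weight-strict M M' M⊆M' M≢M'
        beyond : ∀ k → n * n ≤ weight M + k → ⊥
        beyond zero    bound = <⇒≱ (<-≤-trans heavier (weight-bound M'))
                                    (≤-trans bound (≤-reflexive (+-identityʳ (weight M))))
        beyond (suc k) bound =
          go k M' (≤-trans bound (≤-trans (≤-reflexive (+-suc (weight M) k)) (+-mono-≤ heavier ≤-refl))) PM'
            (λ (M* , max* , M'⊆M*) → no-max (M* , max* , λ x y p → M'⊆M* x y (M⊆M' x y p)))

module SingleEdge {n : ℕ} (u v : Fin n) where

  IsEdge : Fin n → Fin n → Set
  IsEdge x y = (x ≡ u × y ≡ v) ⊎ (x ≡ v × y ≡ u)

  isEdge? : ∀ x y → Dec (IsEdge x y)
  isEdge? x y = (x ≟ u ×-dec y ≟ v) ⊎-dec (x ≟ v ×-dec y ≟ u)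

  single : EdgeSet n
  single = tabulate (λ x → tabulate (λ y → does (isEdge? x y)))

  single-∋ : ∀ {x y} → single ∋ₑ x ─ y ⇔ IsEdge x y
  single-∋ {x} {y} = subst (λ b → (b ≡ true) ⇔ IsEdge x y) (sym lookup-single) (dec-⇔ (isEdge? x y))
    where
    lookup-single : lookup (lookup single x) y ≡ does (isEdge? x y)
    lookup-single = trans (cong (λ row → lookup row y) (lookup∘tabulate _ x)) (lookup∘tabulate _ y)
    dec-⇔ : ∀ {A : Set} (d : Dec A) → (does d ≡ true) ⇔ A
    dec-⇔ (yes a) = mk⇔ (λ _ → a) (λ _ → refl)
    dec-⇔ (no ¬a) = mk⇔ (λ ()) (λ a → ⊥-elim (¬a a))

  uv∈single : single ∋ₑ u ─ v
  uv∈single = from single-∋ (inj₁ (refl , refl))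

  vu∈single : single ∋ₑ v ─ u
  vu∈single = from single-∋ (inj₂ (refl , refl))

  endpoint : ∀ {x} → Covers single x → x ≡ u ⊎ x ≡ v
  endpoint (y , p) with to single-∋ p
  ... | inj₁ (x≡u , _) = inj₁ x≡u
  ... | inj₂ (x≡v , _) = inj₂ x≡v

NoMIMCoversBoth : ∀ {n} → Adj n → Fin n → Fin n → Set
NoMIMCoversBoth E u v = ∀ M → IsMIM E M → ¬ (Covers M u × Covers M v)

module _ {n : ℕ} (G : Graph n) (u v : Fin n) where

  open SingleEdge u v

  single-IM : E G u v → IsInducedMatching (E G) single
  single-IM euv = (edges , symm , func) , λ x c →
      neighbour (endpoint c)
    , λ y z cy exy cz exz → unique (endpoint c) (endpoint cy) (endpoint cz) exy exz
    where
    u≢v : u ≢ v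
    u≢v refl = irrefl G u euv
    edges : ∀ x y → single ∋ₑ x ─ y → E G x y
    edges x y p with to single-∋ p
    ... | inj₁ (refl , refl) = euv
    ... | inj₂ (refl , refl) = Graph.sym G u v euv
    symm : ∀ x y → single ∋ₑ x ─ y → single ∋ₑ y ─ x
    symm x y p with to single-∋ p
    ... | inj₁ (refl , refl) = vu∈single
    ... | inj₂ (refl , refl) = uv∈single
    func : ∀ x y z → single ∋ₑ x ─ y → single ∋ₑ x ─ z → y ≡ z
    func x y z p q with to single-∋ p | to single-∋ q
    ... | inj₁ (refl , refl) | inj₁ (_ , z≡v)   = sym z≡v
    ... | inj₁ (refl , refl) | inj₂ (u≡v , _)   = ⊥-elim (u≢v u≡v)
    ... | inj₂ (refl , refl) | inj₁ (v≡u , _)   = ⊥-elim (u≢v (sym v≡u))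
    ... | inj₂ (refl , refl) | inj₂ (_ , z≡u)   = sym z≡u
    neighbour : ∀ {x} → x ≡ u ⊎ x ≡ v → ∃ λ y → Covers single y × E G x y
    neighbour (inj₁ refl) = v , (u , vu∈single) , euv
    neighbour (inj₂ refl) = u , (v , uv∈single) , Graph.sym G u v euv
    unique : ∀ {x y z} → x ≡ u ⊎ x ≡ v → y ≡ u ⊎ y ≡ v → z ≡ u ⊎ z ≡ v →
             E G x y → E G x z → y ≡ z
    unique _           (inj₁ refl) (inj₁ refl) _   _   = refl
    unique _           (inj₂ refl) (inj₂ refl) _   _   = refl
    unique (inj₁ refl) (inj₁ refl) (inj₂ refl) exy _   = ⊥-elim (irrefl G u exy)
    unique (inj₂ refl) (inj₁ refl) (inj₂ refl) _   exz = ⊥-elim (irrefl G v exz)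
    unique (inj₁ refl) (inj₂ refl) (inj₁ refl) _   exz = ⊥-elim (irrefl G u exz)
    unique (inj₂ refl) (inj₂ refl) (inj₁ refl) exy _   = ⊥-elim (irrefl G v exy)

  -- If no MIM covers both u and v, then u and v are not adjacent: a MIM
  -- containing the induced matching {uv} would cover both.
  nonadjacent : NoMIMCoversBoth (E G) u v → ¬ E G u v
  nonadjacent none euv = extend-to-maximal (IsInducedMatching (E G)) single (single-IM euv)
    λ (M* , mim , single⊆M*) → none M* mim ((v , single⊆M* u v uv∈single) , (u , single⊆M* v u vu∈single))

module TwinShift {n : ℕ} (G : Graph n) (u v : Fin n)
                 (dec : Decidable (E G)) (u≁v : ¬ E G u v) where

  E' : Adj n
  E' = twinShift (E G) u v

  Twin : Fin n → Set
  Twin = InTwinSet (E G) u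

  twin? : ∀ x → Dec (Twin x)
  twin? x = all? (λ z → dec x z ⇔-dec dec u z)

  twin-self : Twin u
  twin-self _ = ⇔.refl

  E'-sym : ∀ a b → E' a b → E' b a
  E'-sym a b (inj₁ (eab , not-deleted)) = inj₁ (Graph.sym G a b eab , λ d → not-deleted (flip-deleted d))
    where
    flip-deleted : Deleted (E G) u v b a → Deleted (E G) u v a b
    flip-deleted (inj₁ d) = inj₂ d
    flip-deleted (inj₂ d) = inj₁ d
  E'-sym a b (inj₂ (inj₁ added)) = inj₂ (inj₂ added)
  E'-sym a b (inj₂ (inj₂ added)) = inj₂ (inj₁ added)

  twin-neighbours : ∀ {w} → Twin w → ∀ y → E' w y ⇔ E G v y
  twin-neighbours {w} tw y = mk⇔ forth back
    where
    forth : E' w y → E G v y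
    forth (inj₁ (ewy , not-deleted)) with dec v y
    ... | yes evy = evy
    ... | no ¬evy = ⊥-elim (not-deleted (inj₁ (tw , to (tw y) ewy , ¬evy)))
    forth (inj₂ (inj₁ (_ , evy , _))) = evy
    forth (inj₂ (inj₂ (_ , evw , _))) = ⊥-elim (u≁v (to (tw v) (Graph.sym G v w evw)))
    back : E G v y → E' w y
    back evy with dec u y
    ... | yes euy = inj₁ (from (tw y) euy , not-deleted)
      where
      not-deleted : ¬ Deleted (E G) u v w y
      not-deleted (inj₁ (_ , _ , ¬evy)) = ¬evy evy
      not-deleted (inj₂ (_ , euw , _))  = irrefl G u (to (tw u) (Graph.sym G u w euw))
    ... | no ¬euy = inj₂ (inj₁ (tw , evy , ¬euy))

  shift-trivial : Twin v → ∀ a b → E G a b ⇔ E' a b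
  shift-trivial tv a b = mk⇔ (λ eab → inj₁ (eab , not-deleted)) back
    where
    not-deleted : ¬ Deleted (E G) u v a b
    not-deleted (inj₁ (_ , eub , ¬evb)) = ¬evb (from (tv b) eub)
    not-deleted (inj₂ (_ , eua , ¬eva)) = ¬eva (from (tv a) eua)
    back : E' a b → E G a b
    back (inj₁ (eab , _))                = eab
    back (inj₂ (inj₁ (_ , evb , ¬eub))) = ⊥-elim (¬eub (to (tv b) evb))
    back (inj₂ (inj₂ (_ , eva , ¬eua))) = ⊥-elim (¬eua (to (tv a) eva))

  shift-outside : ∀ {x y} → ¬ Twin x → ¬ Twin y → E G x y ⇔ E' x y
  shift-outside x∉T y∉T = mk⇔ (λ exy → inj₁ (exy , not-deleted)) back
    where
    not-deleted : ¬ Deleted (E G) u v _ _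
    not-deleted (inj₁ (tx , _)) = x∉T tx
    not-deleted (inj₂ (ty , _)) = y∉T ty
    back : E' _ _ → E G _ _
    back (inj₁ (exy , _))       = exy
    back (inj₂ (inj₁ (tx , _))) = ⊥-elim (x∉T tx)
    back (inj₂ (inj₂ (ty , _))) = ⊥-elim (y∉T ty)

  module _ (v∉T : ¬ Twin v) where

    v-neighbours : ∀ z → E' v z ⇔ E G v z
    v-neighbours z = mk⇔ forth (λ evz → inj₁ (evz , not-deleted))
      where
      forth : E' v z → E G v z
      forth (inj₁ (evz , _))             = evz
      forth (inj₂ (inj₁ (tv , _)))       = ⊥-elim (v∉T tv)
      forth (inj₂ (inj₂ (_ , evv , _))) = ⊥-elim (irrefl G v evv)
      not-deleted : ¬ Deleted (E G) u v v z
      not-deleted (inj₁ (tv , _))       = v∉T tv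
      not-deleted (inj₂ (_ , euv , _)) = u≁v euv

    InClass : Fin n → Set
    InClass a = Twin a ⊎ a ≡ v

    class-neighbours : ∀ {a} → InClass a → InTwinSet E' v a
    class-neighbours (inj₂ refl) z = ⇔.refl
    class-neighbours (inj₁ ta)   z = ⇔.trans (twin-neighbours ta z) (⇔.sym (v-neighbours z))

    class-exclusive : ∀ M → IsInducedMatching E' M → ∀ {a b} → InClass a → InClass b → a ≢ b →
      Covers M a → Covers M b → ⊥
    class-exclusive M im ca cb = dominated-not-both-covered M im
      (λ z eaz → from (class-neighbours cb z) (to (class-neighbours ca z) eaz))

covers? : ∀ {n} (M : EdgeSet n) x → Dec (Covers M x)
covers? M x = any? (λ y → lookup (lookup M x) y Bool.≟ true)

covering : ∀ {n} → List (EdgeSet n) → Fin n → List (EdgeSet n)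
covering l x = filter (λ M → covers? M x) l

_≟ₑ_ : ∀ {n} → DecidableEquality (EdgeSet n)
_≟ₑ_ = ≡-dec (≡-dec Bool._≟_)

module ShiftInjection {n : ℕ} (G : Graph n) (u v : Fin n) (dec : Decidable (E G))
         (hyp : NoMIMCoversBoth (E G) u v)
         (lG : List (EdgeSet n)) (lG-unique : Unique lG)
         (lG-enum : ∀ M → (M ∈ lG) ⇔ IsMIM (E G) M)
         (lG' : List (EdgeSet n))
         (lG'-enum : ∀ M → (M ∈ lG') ⇔ IsMIM (twinShift (E G) u v) M) where

  open TwinShift G u v dec (nonadjacent G u v hyp)

  ∈-covering : ∀ {M x} → M ∈ covering lG x ⇔ (IsMIM (E G) M × Covers M x)
  ∈-covering {M} {x} = mk⇔
    (λ m → let m∈lG , c = ∈-filter⁻ (λ M → covers? M x) {xs = lG} m in to (lG-enum M) m∈lG , c)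
    (λ (mim , c) → ∈-filter⁺ (λ M → covers? M x) (from (lG-enum M) mim) c)

  Avoids : EdgeSet n → Set
  Avoids M = ∀ w → Twin w → ¬ Covers M w

  coversTwin? : ∀ M → Dec (∃ λ w → Twin w × Covers M w)
  coversTwin? M = any? (λ w → twin? w ×-dec covers? M w)

  swapG-hom : ∀ {w} → Twin w → ∀ a b → E G a b → E G (transpose u w a) (transpose u w b)
  swapG-hom {w} tw = transpose-twins-hom u w (E G) (Graph.sym G) tw

  module _ (v∉T : ¬ Twin v) where

    twin≢v : ∀ {w} → Twin w → w ≢ v
    twin≢v tw refl = v∉T tw

    swapG'-hom : ∀ {w} → Twin w → ∀ a b → E' a b → E' (transpose v w a) (transpose v w b)
    swapG'-hom {w} tw = transpose-twins-hom v w E' E'-sym (class-neighbours v∉T (inj₁ tw))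

    avoiding-IM : ∀ M → Avoids M → IsInducedMatching (E G) M ⇔ IsInducedMatching E' M
    avoiding-IM M av = mk⇔ (IM-transfer (λ x → ¬ Twin x) M outside (λ _ _ x∉T y∉T → shift-outside x∉T y∉T))
                          (IM-transfer (λ x → ¬ Twin x) M outside (λ _ _ x∉T y∉T → ⇔.sym (shift-outside x∉T y∉T)))
      where
      outside : ∀ x → Covers M x → ¬ Twin x
      outside x c tx = av x tx c

    rerouted-avoids : ∀ M' → IsInducedMatching E' M' → ∀ {w} → Twin w → Covers M' w →
      Avoids (relabel (transpose v w) M')
    rerouted-avoids M' im' {w} tw cw x tx c = by-cases (x ≟ w)
      where
      c' : Covers M' (transpose v w x)
      c' = to (covers-relabel (transpose v w) (transpose-involutive v w) M') c
      by-cases : Dec (x ≡ w) → ⊥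
      by-cases (yes refl) = class-exclusive v∉T M' im' (inj₂ refl) (inj₁ tw) (λ v≡x → twin≢v tx (sym v≡x))
                              (subst (Covers M') (transpose-right v x) c') cw
      by-cases (no x≢w)   = class-exclusive v∉T M' im' (inj₁ tx) (inj₁ tw) x≢w
                              (subst (Covers M') (transpose-other v w (twin≢v tx) x≢w) c') cw

    -- A MIM of G avoiding T(u) is a MIM of G'.  A larger induced matching M'
    -- of G' covering some w ∈ T(u) would, after applying (v w), give a larger
    -- induced matching of G.
    maximal-in-shift : ∀ M → IsMIM (E G) M → Avoids M → IsMIM E' M
    maximal-in-shift M (im , maximal) av = to (avoiding-IM M av) im , no-larger
      where
      no-larger : ∀ M' → IsInducedMatching E' M' → M ⊆ₑ M' → M ≢ M' → ⊥
      no-larger M' im' M⊆M' M≢M' with coversTwin? M'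
      ... | no none = maximal M' (from (avoiding-IM M' (λ w tw cw → none (w , tw , cw))) im') M⊆M' M≢M'
      ... | yes (w , tw , cw) =
        maximal M'' (from (avoiding-IM M'' (rerouted-avoids M' im' tw cw))
                          (IM-relabel τ τ-inv (swapG'-hom tw) M' im'))
                M⊆M'' M≢M''
        where
        τ = transpose v w
        τ-inv = transpose-involutive v w
        M'' = relabel τ M'
        ¬cv : ¬ Covers M' v
        ¬cv cv = class-exclusive v∉T M' im' (inj₁ tw) (inj₂ refl) (twin≢v tw) cw cv
        cv'' : Covers M'' v
        cv'' = from (covers-relabel τ τ-inv M') (subst (Covers M') (sym (transpose-left v w)) cw)
        -- M covers neither v nor w, so τ fixes its vertices.
        fixed : ∀ {x} → Covers M x → τ x ≡ x
        fixed {x} (y , p) = transpose-other v w (λ { refl → ¬cv (y , M⊆M' _ _ p) })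
                                                (λ { refl → av w tw (y , p) })
        M⊆M'' : M ⊆ₑ M''
        M⊆M'' x y p = from (relabel-∋ τ M')
          (subst₂ (λ a b → M' ∋ₑ a ─ b) (sym (fixed (y , p))) (sym (fixed (x , symm x y p))) (M⊆M' x y p))
          where symm = proj₁ (proj₂ (proj₁ im))
        M≢M'' : M ≢ M''
        M≢M'' M≡M'' with subst (λ X → Covers X v) (sym M≡M'') cv''
        ... | y , p = ¬cv (y , M⊆M' v y p)

    -- A MIM of G covering v avoids T(u): otherwise (u w) would move it to a
    -- MIM covering both u and v.
    covers-v-avoids : ∀ M → IsMIM (E G) M → Covers M v → Avoids M
    covers-v-avoids M mim cv w tw cw = hyp (relabel τ M) (MIM-relabel τ τ-inv (swapG-hom tw) M mim) (cu , cv')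
      where
      τ = transpose u w
      τ-inv = transpose-involutive u w
      cu : Covers (relabel τ M) u
      cu = from (covers-relabel τ τ-inv M) (subst (Covers M) (sym (transpose-left u w)) cw)
      cv' : Covers (relabel τ M) v
      cv' = from (covers-relabel τ τ-inv M)
        (subst (Covers M) (sym (transpose-other u w (twin≢v twin-self ∘ sym) (twin≢v tw ∘ sym))) cv)

    module _ (fewer : length (covering lG u) ≤ length (covering lG v)) where

      pair : EdgeSet n → EdgeSet n
      pair = pairing _≟ₑ_ (covering lG u) (covering lG v)

      transplant : Fin n → EdgeSet n → EdgeSet n
      transplant w M = relabel (transpose v w) (pair (relabel (transpose u w) M))

      moved-to-u : ∀ {w M} → Twin w → IsMIM (E G) M → Covers M w → relabel (transpose u w) M ∈ covering lG u
      moved-to-u {w} {M} tw mim cw = from ∈-covering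
        ( MIM-relabel (transpose u w) (transpose-involutive u w) (swapG-hom tw) M mim
        , from (covers-relabel (transpose u w) (transpose-involutive u w) M)
            (subst (Covers M) (sym (transpose-left u w)) cw) )

      transplant-MIM : ∀ {w M} → Twin w → IsMIM (E G) M → Covers M w →
        IsMIM E' (transplant w M) × Covers (transplant w M) w
      transplant-MIM {w} {M} tw mim cw =
          MIM-relabel (transpose v w) (transpose-involutive v w) (swapG'-hom tw) M₂
            (maximal-in-shift M₂ mim₂ (covers-v-avoids M₂ mim₂ cv₂))
        , from (covers-relabel (transpose v w) (transpose-involutive v w) M₂)
            (subst (Covers M₂) (sym (transpose-right v w)) cv₂)
        where
        M₂ = pair (relabel (transpose u w) M)
        M₂-covers-v : IsMIM (E G) M₂ × Covers M₂ v
        M₂-covers-v = to ∈-covering (pairing-∈ _≟ₑ_ (covering lG u) (covering lG v) fewer (moved-to-u tw mim cw))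
        mim₂ = proj₁ M₂-covers-v
        cv₂ = proj₂ M₂-covers-v

      transplant-injective : ∀ {w M M₁} → Twin w → IsMIM (E G) M → IsMIM (E G) M₁ →
        Covers M w → Covers M₁ w → transplant w M ≡ transplant w M₁ → M ≡ M₁
      transplant-injective {w} tw mim mim₁ cw cw₁ eq =
        relabel-injective (transpose u w) (transpose-involutive u w)
          (pairing-injective _≟ₑ_ (covering lG u) (covering lG v) fewer
            (Unique.filter⁺ (λ M → covers? M v) lG-unique)
            (moved-to-u tw mim cw) (moved-to-u tw mim₁ cw₁)
            (relabel-injective (transpose v w) (transpose-involutive v w) eq))

      shiftMap : EdgeSet n → EdgeSet n
      shiftMap M with coversTwin? M
      ... | yes (w , _) = transplant w M
      ... | no  _       = M

      shiftMap-MIM : ∀ M → IsMIM (E G) M → IsMIM E' (shiftMap M)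
      shiftMap-MIM M mim with coversTwin? M
      ... | yes (w , tw , cw) = proj₁ (transplant-MIM tw mim cw)
      ... | no  none          = maximal-in-shift M mim (λ w tw cw → none (w , tw , cw))

      -- Injectivity: a transplanted image covers its twin w, which determines
      -- w (class-exclusive) and distinguishes it from the kept MIMs.
      shiftMap-injective : ∀ M M₁ → IsMIM (E G) M → IsMIM (E G) M₁ → shiftMap M ≡ shiftMap M₁ → M ≡ M₁
      shiftMap-injective M M₁ mim mim₁ eq with coversTwin? M | coversTwin? M₁
      ... | yes (w , tw , cw) | yes (w₁ , tw₁ , cw₁) =
        transplant-injective tw mim mim₁ cw (subst (Covers M₁) (sym w≡w₁) cw₁)
          (trans eq (cong (λ x → transplant x M₁) (sym w≡w₁)))
        where
        image = transplant-MIM tw mim cw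
        w≡w₁ : w ≡ w₁
        w≡w₁ with w ≟ w₁
        ... | yes w≡w₁ = w≡w₁
        ... | no  w≢w₁ = ⊥-elim (class-exclusive v∉T (transplant w M) (proj₁ (proj₁ image)) (inj₁ tw) (inj₁ tw₁) w≢w₁
                           (proj₂ image) (subst (λ X → Covers X w₁) (sym eq) (proj₂ (transplant-MIM tw₁ mim₁ cw₁))))
      ... | yes (w , tw , cw) | no none₁ =
        ⊥-elim (none₁ (w , tw , subst (λ X → Covers X w) eq (proj₂ (transplant-MIM tw mim cw))))
      ... | no none | yes (w₁ , tw₁ , cw₁) =
        ⊥-elim (none (w₁ , tw₁ , subst (λ X → Covers X w₁) (sym eq) (proj₂ (transplant-MIM tw₁ mim₁ cw₁))))
      ... | no _ | no _ = eq

  shift-dominates : length (covering lG u) ≤ length (covering lG v) → length lG ≤ length lG'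
  shift-dominates fewer with twin? v
  ... | yes v∈T = injection-length lG lG' (λ M → M) lG-unique
        (λ {M} m → from (lG'-enum M) (MIM-transfer (shift-trivial v∈T) M (to (lG-enum M) m)))
        (λ _ _ eq → eq)
  ... | no  v∉T = injection-length lG lG' (shiftMap v∉T fewer) lG-unique
        (λ {M} m → from (lG'-enum _) (shiftMap-MIM v∉T fewer M (to (lG-enum M) m)))
        (λ {M} {M₁} m m₁ → shiftMap-injective v∉T fewer M M₁ (to (lG-enum M) m) (to (lG-enum M₁) m₁))

lemma2-decidable : ∀ {n} (G : Graph n) (u v : Fin n) → Decidable (E G) →
  NoMIMCoversBoth (E G) u v → ∀ {a b c} →
  HasCount (IsMIM (E G)) a →
  HasCount (IsMIM (twinShift (E G) u v)) b →
  HasCount (IsMIM (twinShift (E G) v u)) c →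
  a ≤ b ⊎ a ≤ c
lemma2-decidable G u v dec hyp (lG , refl , lG-unique , lG-enum) (lG₁ , refl , _ , lG₁-enum) (lG₂ , refl , _ , lG₂-enum)
  with ≤-total (length (covering lG u)) (length (covering lG v))
... | inj₁ u≤v = inj₁ (ShiftInjection.shift-dominates G u v dec hyp lG lG-unique lG-enum lG₁ lG₁-enum u≤v)
... | inj₂ v≤u = inj₂ (ShiftInjection.shift-dominates G v u dec (λ M mim (cv , cu) → hyp M mim (cu , cv))
                         lG lG-unique lG-enum lG₂ lG₂-enum v≤u)

-- The conclusion is decidable, so the double-negated decidability of
-- adjacency suffices.
lemma2 : ∀ {n} (G : Graph n) (u v : Fin n) →
         (∀ M → IsMaximalInducedMatching (E G) M → ¬ (Covers M u × Covers M v)) →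
         ∀ a b c →
         HasCount (IsMaximalInducedMatching (E G)) a →
         HasCount (IsMaximalInducedMatching (twinShift (E G) u v)) b →
         HasCount (IsMaximalInducedMatching (twinShift (E G) v u)) c →
         a ≤ b ⊎ a ≤ c
lemma2 G u v hyp a b c count count₁ count₂ =
  decidable-stable (a ≤? b ⊎-dec a ≤? c) λ ¬goal →
    ¬¬-decidable (E G) λ dec → ¬goal (lemma2-decidable G u v dec hyp count count₁ count₂)
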